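{- Fix $\alpha\in(0,1]$ and let $v=\mathrm{lazy}\text{ - }\alpha\text{ - }\mathrm{flipext}^{\omega}(1)$. Let $s=s'_{\alpha,0}$ be the upper mechanical word of slope $\alpha$ and intercept $0$. Then $v=s$.
   Context: Binary words are indexed from $1$; $P_w(i)$ is the number of $1$s in the prefix of length $i$ of $w$, $D_w(i)=P_w(i)/i$, and for finite $w$, $\delta(w)=\min\{D_w(i):1\le i\le|w|\}$. For $\alpha\in(0,1]$ and a finite binary word $w$ (prefix normal) with $\delta(w)\ge\alpha$, $\mathrm{lazy}\text{ - }\alpha\text{ - }\mathrm{flipext}(w)=w0^k1$ with $k=\max\{j\ge0:\delta(w0^j)\ge\alpha\}$, and $\mathrm{lazy}\text{ - }\alpha\text{ - }\mathrm{flipext}^{\omega}(w)$ is the infinite limit of iterating this operation starting from $w$. The upper mechanical word of slope $\alpha$ and intercept $\tau$ is $s'_{\alpha,\tau}$ with $s'_{\alpha,\tau}(n)=\lceil\alpha n+\tau\rceil-\lceil\alpha(n-1)+\tau\rceil$ for $n\ge1$. -}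

module Defs where

open import Data.Nat using (ℕ; zero; suc; _+_; _≤_; _∸_)
open import Data.Integer using (+_)
open import Data.Rational using (ℚ; _/_; 0ℚ; 1ℚ) renaming (_≤_ to _≤ℚ_; _<_ to _<ℚ_)
open import Data.Bool using (Bool; true; false)
open import Data.List using (List; []; _∷_; _++_; replicate; take; length)
open import Data.Product using (Σ; _×_)
open import Data.Unit using (⊤)
open import Relation.Nullary using (¬_)
open import Relation.Binary.PropositionalEquality using (_≡_)

-- A real number α ∈ (0,1], represented by its upper rational cut
-- U = { q ∈ ℚ : α ≤ q } = [α,∞) ∩ ℚ.  Every α ∈ (0,1] gives such a cut, and
-- every such cut determines a unique α = inf U ∈ (0,1].
record Slope : Set₁ where
  field
    U        : ℚ → Set
    upward   : ∀ {q r} → U q → q ≤ℚ r → U r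
    one∈U    : U 1ℚ
    zero∉U   : ¬ U 0ℚ         -- together with lower-openness: α > 0
    lowerOpen : ∀ {q} → ¬ U q → Σ ℚ (λ r → (q <ℚ r) × ¬ U r)
open Slope public

-- AtLeast α m n  means  m ≥ α·n   (i.e. m/n ≥ α for n ≥ 1)
AtLeast : Slope → ℕ → ℕ → Set
AtLeast α m zero    = ⊤
AtLeast α m (suc n) = U α ((+ m) / suc n)

IsCeil : Slope → ℕ → ℕ → Set
IsCeil α n c = AtLeast α c n × (∀ c' → AtLeast α c' n → c ≤ c')

ones : List Bool → ℕ
ones []           = 0
ones (true ∷ xs)  = suc (ones xs)
ones (false ∷ xs) = ones xs

P : List Bool → ℕ → ℕ
P w i = ones (take i w)

-- δ(w) ≥ α  :  D_w(i) = P_w(i)/i ≥ α for all 1 ≤ i ≤ |w|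
δ≥ : List Bool → Slope → Set
δ≥ w α = ∀ i → 1 ≤ i → i ≤ length w → AtLeast α (P w i) i

-- LazyStep α w w' : w' = lazy-α-flipext(w) = w 0^k 1 with
-- k = max { j ≥ 0 : δ(w 0^j) ≥ α }
LazyStep : Slope → List Bool → List Bool → Set
LazyStep α w w' =
  Σ ℕ (λ k → δ≥ (w ++ replicate k false) α
           × (∀ j → δ≥ (w ++ replicate j false) α → j ≤ k)
           × (w' ≡ w ++ replicate k false ++ (true ∷ [])))

-- letter w n : the n-th letter of w (1-indexed); default false out of range
letter : List Bool → ℕ → Bool
letter []       _             = false
letter (x ∷ xs) zero          = false
letter (x ∷ xs) (suc zero)    = x
letter (x ∷ xs) (suc (suc n)) = letter xs (suc n)

b2n : Bool → ℕ
b2n true  = 1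
b2n false = 0

-- Let w be a prefix of the upper mechanical word s = s'_{α,0}, i.e. P_w(i) = ⌈α i⌉
-- for all i ≤ |w|; then w 0^k 1 = lazy-α-flipext(w) is again such a prefix.  Inside
-- the block of zeros the prefix count stays ⌈α|w|⌉, which is ≥ α i because
-- δ(w 0^k) ≥ α, so it is ⌈α i⌉ by monotonicity of the ceiling.  At the final 1 the
-- count ⌈α|w|⌉ + 1 is ≥ α(|w| + k + 1) since α ≤ 1, while maximality of k says
-- ⌈α|w|⌉ < α(|w| + k + 1); so it is the ceiling there too.  The letters of
-- the iterates are thus the differences ⌈α n⌉ - ⌈α (n-1)⌉.
module Submission where

open import Defs
open import Data.Nat using (ℕ; suc; _≤_; _∸_)
open import Data.Bool using (Bool; true)
open import Data.List using (List; []; _∷_; length)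
open import Relation.Binary.PropositionalEquality using (_≡_)

open import Data.Nat using (zero; _+_; _*_; z≤n; s≤s)
open import Data.Nat.Properties
  using (_≤?_; ≤-refl; ≤-trans; ≤-antisym; <⇒≤; ≰⇒>; 1+n≰n; m≤n⇒m≤1+n; m≤n⇒m<n∨m≡n;
         m<1+n⇒m≤n; m≤m+n; +-monoʳ-≤; +-monoˡ-≤; *-monoˡ-≤; *-monoʳ-≤; +-suc; +-comm;
         +-identityʳ; *-suc; *-identityˡ; *-identityʳ; m+n∸n≡m; m+n∸m≡n; m+[n∸m]≡n; m∸n≤m;
         ∸-monoˡ-≤)
open import Data.Bool using (false)
open import Data.List using (_++_; replicate)
open import Data.List.Properties using (length-++; length-replicate)
open import Data.Product using (_,_)
open import Data.Sum using (inj₁; inj₂)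
open import Data.Unit using (tt)
open import Data.Empty using (⊥-elim)
open import Relation.Nullary using (¬_; yes; no)
open import Relation.Binary.PropositionalEquality
  using (refl; sym; trans; cong; cong₂; subst; subst₂; module ≡-Reasoning)
import Data.Integer as ℤ
open import Data.Integer.Properties using (pos-*)
open import Data.Rational using (_/_; fromℚᵘ) renaming (_≤_ to _≤ℚ_)
open import Data.Rational.Properties using (toℚᵘ-cancel-≤; toℚᵘ-fromℚᵘ)
open import Data.Rational.Unnormalised using (ℚᵘ; mkℚᵘ; *≤*) renaming (_≤_ to _≤ᵘ_)
open import Data.Rational.Unnormalised.Properties using (≤-respˡ-≃; ≤-respʳ-≃; ≃-sym)

fromℚᵘ-mono-≤ : ∀ {p q : ℚᵘ} → p ≤ᵘ q → fromℚᵘ p ≤ℚ fromℚᵘ q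
fromℚᵘ-mono-≤ {p} {q} p≤q = toℚᵘ-cancel-≤
  (≤-respˡ-≃ (≃-sym (toℚᵘ-fromℚᵘ p)) (≤-respʳ-≃ (≃-sym (toℚᵘ-fromℚᵘ q)) p≤q))

/-cross-≤ : ∀ {m n d e} → m * suc e ≤ n * suc d → (ℤ.+ m) / suc d ≤ℚ (ℤ.+ n) / suc e
/-cross-≤ {m} {n} {d} {e} h =
  fromℚᵘ-mono-≤ {mkℚᵘ (ℤ.+ m) d} {mkℚᵘ (ℤ.+ n) e}
    (*≤* (subst₂ ℤ._≤_ (pos-* m (suc e)) (pos-* n (suc d)) (ℤ.+≤+ h)))

split-at : ∀ {Q : ℕ → Set} L m → (∀ i → i ≤ L → Q i) → (∀ j → j ≤ m → Q (L + j))
         → ∀ i → i ≤ L + m → Q i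
split-at {Q} L m below above i i≤L+m with i ≤? L
... | yes i≤L = below i i≤L
... | no i≰L = subst Q (m+[n∸m]≡n L≤i) (above (i ∸ L) i∸L≤m)
  where
  L≤i : L ≤ i
  L≤i = <⇒≤ (≰⇒> i≰L)
  i∸L≤m : i ∸ L ≤ m
  i∸L≤m = subst (i ∸ L ≤_) (m+n∸m≡n L m) (∸-monoˡ-≤ L i≤L+m)

P-++ˡ : ∀ xs ys {i} → i ≤ length xs → P (xs ++ ys) i ≡ P xs i
P-++ˡ _            _  {zero}  _       = refl
P-++ˡ (true ∷ xs)  ys {suc i} (s≤s h) = cong suc (P-++ˡ xs ys h)
P-++ˡ (false ∷ xs) ys {suc i} (s≤s h) = P-++ˡ xs ys h

P-++ʳ : ∀ xs ys j → P (xs ++ ys) (length xs + j) ≡ ones xs + P ys j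
P-++ʳ []           ys j = refl
P-++ʳ (true ∷ xs)  ys j = cong suc (P-++ʳ xs ys j)
P-++ʳ (false ∷ xs) ys j = P-++ʳ xs ys j

P-≥length : ∀ xs {i} → length xs ≤ i → P xs i ≡ ones xs
P-≥length []           {zero}  _       = refl
P-≥length []           {suc i} _       = refl
P-≥length (true ∷ xs)  {suc i} (s≤s h) = cong suc (P-≥length xs h)
P-≥length (false ∷ xs) {suc i} (s≤s h) = P-≥length xs h

P-replicate-false : ∀ k i → P (replicate k false) i ≡ 0
P-replicate-false zero    zero    = refl
P-replicate-false zero    (suc i) = refl
P-replicate-false (suc k) zero    = refl
P-replicate-false (suc k) (suc i) = P-replicate-false k i

P-++-replicate-false : ∀ w k i → P (w ++ replicate k false) i ≡ P w i
P-++-replicate-false w           k zero    = refl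
P-++-replicate-false []          k (suc i) = P-replicate-false k (suc i)
P-++-replicate-false (true ∷ w)  k (suc i) = cong suc (P-++-replicate-false w k i)
P-++-replicate-false (false ∷ w) k (suc i) = P-++-replicate-false w k i

length-++-replicate : ∀ (w : List Bool) k → length (w ++ replicate k false) ≡ length w + k
length-++-replicate w k = trans (length-++ w) (cong (length w +_) (length-replicate k))

zerosThenOne : ℕ → List Bool
zerosThenOne k = replicate k false ++ true ∷ []

length-zerosThenOne : ∀ k → length (zerosThenOne k) ≡ suc k
length-zerosThenOne zero    = refl
length-zerosThenOne (suc k) = cong suc (length-zerosThenOne k)

P-zerosThenOne-≤ : ∀ {k j} → j ≤ k → P (zerosThenOne k) j ≡ 0
P-zerosThenOne-≤ {k}     {zero}  _       = refl
P-zerosThenOne-≤ {suc k} {suc j} (s≤s h) = P-zerosThenOne-≤ h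

P-zerosThenOne-end : ∀ k → P (zerosThenOne k) (suc k) ≡ 1
P-zerosThenOne-end zero    = refl
P-zerosThenOne-end (suc k) = P-zerosThenOne-end k

P-++-zerosThenOne-≤ : ∀ w {k j} → j ≤ k → P (w ++ zerosThenOne k) (length w + j) ≡ ones w
P-++-zerosThenOne-≤ w {k} {j} j≤k = begin
  P (w ++ zerosThenOne k) (length w + j)  ≡⟨ P-++ʳ w (zerosThenOne k) j ⟩
  ones w + P (zerosThenOne k) j           ≡⟨ cong (ones w +_) (P-zerosThenOne-≤ j≤k) ⟩
  ones w + 0                              ≡⟨ +-identityʳ (ones w) ⟩
  ones w                                  ∎
  where open ≡-Reasoning

P-++-zerosThenOne-end : ∀ w k → P (w ++ zerosThenOne k) (length w + suc k) ≡ suc (ones w)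
P-++-zerosThenOne-end w k = begin
  P (w ++ zerosThenOne k) (length w + suc k)  ≡⟨ P-++ʳ w (zerosThenOne k) (suc k) ⟩
  ones w + P (zerosThenOne k) (suc k)         ≡⟨ cong (ones w +_) (P-zerosThenOne-end k) ⟩
  ones w + 1                                  ≡⟨ +-comm (ones w) 1 ⟩
  suc (ones w)                                ∎
  where open ≡-Reasoning

P-letter : ∀ w n → 1 ≤ n → n ≤ length w → b2n (letter w n) + P w (n ∸ 1) ≡ P w n
P-letter (true ∷ xs)  (suc zero)    _ _       = refl
P-letter (false ∷ xs) (suc zero)    _ _       = refl
P-letter (true ∷ xs)  (suc (suc n)) _ (s≤s h) =
  trans (+-suc _ _) (cong suc (P-letter xs (suc n) (s≤s z≤n) h))
P-letter (false ∷ xs) (suc (suc n)) _ (s≤s h) = P-letter xs (suc n) (s≤s z≤n) h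

module _ (α : Slope) where

  AtLeast-monoˡ-≤ : ∀ {a b} n → a ≤ b → AtLeast α a n → AtLeast α b n
  AtLeast-monoˡ-≤ zero    _   _ = tt
  AtLeast-monoˡ-≤ {a} {b} (suc n) a≤b x =
    upward α x (/-cross-≤ {a} {b} {n} {n} (*-monoˡ-≤ (suc n) a≤b))

  AtLeast-antimonoʳ-≤ : ∀ c {m n} → m ≤ n → AtLeast α c n → AtLeast α c m
  AtLeast-antimonoʳ-≤ c {zero}  _       _ = tt
  AtLeast-antimonoʳ-≤ c {suc m} {suc n} m≤n x =
    upward α x (/-cross-≤ {c} {c} {n} {m} (*-monoʳ-≤ c m≤n))

  AtLeast-≥ : ∀ {c n} → n ≤ c → AtLeast α c n
  AtLeast-≥ {c} {zero}  _   = tt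
  AtLeast-≥ {c} {suc n} n≤c =
    upward α (one∈U α) (/-cross-≤ {1} {c} {0} {n}
      (subst₂ _≤_ (sym (*-identityˡ (suc n))) (sym (*-identityʳ c)) n≤c))

  -- The mediant (a + 1)/(n + 1) is at least min(a/n, 1), and 1 ≥ α.
  AtLeast-suc : ∀ a n → AtLeast α a n → AtLeast α (suc a) (suc n)
  AtLeast-suc a zero    _ = AtLeast-≥ {suc a} {1} (s≤s z≤n)
  AtLeast-suc a (suc m) x with a ≤? suc m
  ... | yes a≤n = upward α x (/-cross-≤ {a} {suc a} {m} {suc m}
        (subst (_≤ suc m + a * suc m) (sym (*-suc a (suc m))) (+-monoˡ-≤ (a * suc m) a≤n)))
  ... | no a≰n = AtLeast-≥ {suc a} {suc (suc m)} (m≤n⇒m≤1+n (≰⇒> a≰n))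

  IsCeil-unique : ∀ {n c d} → IsCeil α n c → IsCeil α n d → c ≡ d
  IsCeil-unique (c≥ , c-least) (d≥ , d-least) = ≤-antisym (c-least _ d≥) (d-least _ c≥)

  IsCeil-zero : IsCeil α 0 0
  IsCeil-zero = tt , λ _ _ → z≤n

  IsCeil-plateau : ∀ {m n c} → m ≤ n → IsCeil α m c → AtLeast α c n → IsCeil α n c
  IsCeil-plateau m≤n (_ , c-least) c≥ = c≥ , λ c' x → c-least c' (AtLeast-antimonoʳ-≤ c' m≤n x)

  IsCeil-suc : ∀ {a n} → AtLeast α a n → ¬ AtLeast α a (suc n) → IsCeil α (suc n) (suc a)
  IsCeil-suc {a} {n} a≥ a≱ = AtLeast-suc a n a≥ , least
    where
    least : ∀ c → AtLeast α c (suc n) → suc a ≤ c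
    least c c≥ with c ≤? a
    ... | yes c≤a = ⊥-elim (a≱ (AtLeast-monoˡ-≤ (suc n) c≤a c≥))
    ... | no c≰a = ≰⇒> c≰a

  δ≥-at : ∀ {w i} → δ≥ w α → i ≤ length w → AtLeast α (P w i) i
  δ≥-at {i = zero}  _ _   = tt
  δ≥-at {i = suc i} δ i≤ = δ (suc i) (s≤s z≤n) i≤

  δ≥-++-replicate-suc : ∀ w k → δ≥ (w ++ replicate k false) α
    → AtLeast α (ones w) (suc (length w + k)) → δ≥ (w ++ replicate (suc k) false) α
  δ≥-++-replicate-suc w k δk ones≥ i 1≤i i≤ =
    subst (λ p → AtLeast α p i) (sym (P-++-replicate-false w (suc k) i)) w-at-i
    where
    L : ℕ
    L = length w
    i≤L+1+k : i ≤ suc (L + k)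
    i≤L+1+k = subst (i ≤_) (trans (length-++-replicate w (suc k)) (+-suc L k)) i≤
    w-at-i : AtLeast α (P w i) i
    w-at-i with m≤n⇒m<n∨m≡n i≤L+1+k
    ... | inj₁ i<1+L+k = subst (λ p → AtLeast α p i) (P-++-replicate-false w k i)
          (δk i 1≤i (subst (i ≤_) (sym (length-++-replicate w k)) (m<1+n⇒m≤n i<1+L+k)))
    ... | inj₂ refl =
          subst (λ p → AtLeast α p i) (sym (P-≥length w (m≤n⇒m≤1+n (m≤m+n L k)))) ones≥

  UpperMechanicalPrefix : List Bool → Set
  UpperMechanicalPrefix w = ∀ i → i ≤ length w → IsCeil α i (P w i)

  UpperMechanicalPrefix-[1] : UpperMechanicalPrefix (true ∷ [])
  UpperMechanicalPrefix-[1] zero          _ = IsCeil-zero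
  UpperMechanicalPrefix-[1] (suc zero)    _ = IsCeil-suc {0} {0} tt (zero∉U α)
  UpperMechanicalPrefix-[1] (suc (suc i)) (s≤s ())

  LazyStep-preserves : ∀ {w w'} → LazyStep α w w'
    → UpperMechanicalPrefix w → UpperMechanicalPrefix w'
  LazyStep-preserves {w} (k , δk , maximal , refl) prefix i i≤ =
    split-at L (suc k) old new i (subst (i ≤_) length-w' i≤)
    where
    L a : ℕ
    L = length w
    a = ones w
    w' : List Bool
    w' = w ++ zerosThenOne k
    length-w' : length w' ≡ L + suc k
    length-w' = trans (length-++ w) (cong (L +_) (length-zerosThenOne k))
    old : ∀ i → i ≤ L → IsCeil α i (P w' i)
    old i i≤L = subst (IsCeil α i) (sym (P-++ˡ w (zerosThenOne k) i≤L)) (prefix i i≤L)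
    ceil-L : IsCeil α L a
    ceil-L = subst (IsCeil α L) (P-≥length w ≤-refl) (prefix L ≤-refl)
    zeros-≥ : ∀ j → j ≤ k → AtLeast α a (L + j)
    zeros-≥ j j≤k = subst (λ p → AtLeast α p (L + j))
      (trans (P-++-replicate-false w k (L + j)) (P-≥length w (m≤m+n L j)))
      (δ≥-at δk (subst (L + j ≤_) (sym (length-++-replicate w k)) (+-monoʳ-≤ L j≤k)))
    not-AtLeast-next : ¬ AtLeast α a (suc (L + k))
    not-AtLeast-next a≥ = 1+n≰n (maximal (suc k) (δ≥-++-replicate-suc w k δk a≥))
    new : ∀ j → j ≤ suc k → IsCeil α (L + j) (P w' (L + j))
    new j j≤1+k with m≤n⇒m<n∨m≡n j≤1+k
    ... | inj₁ j<1+k = subst (IsCeil α (L + j)) (sym (P-++-zerosThenOne-≤ w j≤k))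
                         (IsCeil-plateau (m≤m+n L j) ceil-L (zeros-≥ j j≤k))
      where
      j≤k : j ≤ k
      j≤k = m<1+n⇒m≤n j<1+k
    ... | inj₂ refl = subst₂ (IsCeil α) (sym (+-suc L k)) (sym (P-++-zerosThenOne-end w k))
                        (IsCeil-suc (zeros-≥ k ≤-refl) not-AtLeast-next)

  lazyIterates-upperMechanical : (u : ℕ → List Bool) → u 0 ≡ true ∷ []
    → (∀ m → LazyStep α (u m) (u (suc m))) → ∀ m → UpperMechanicalPrefix (u m)
  lazyIterates-upperMechanical u u₀ step zero    =
    subst UpperMechanicalPrefix (sym u₀) UpperMechanicalPrefix-[1]
  lazyIterates-upperMechanical u u₀ step (suc m) =
    LazyStep-preserves (step m) (lazyIterates-upperMechanical u u₀ step m)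

lemma5 : (α : Slope) (u : ℕ → List Bool)
           → u 0 ≡ true ∷ []
           → (∀ m → LazyStep α (u m) (u (suc m)))
           → ∀ m n c c' → 1 ≤ n → n ≤ length (u m)
           → IsCeil α n c → IsCeil α (n ∸ 1) c'
           → b2n (letter (u m) n) ≡ c ∸ c'
lemma5 α u u₀ step m n c c' 1≤n n≤ ceil-n ceil-n-1 = begin
  b2n (letter w n)                              ≡⟨ sym (m+n∸n≡m _ (P w (n ∸ 1))) ⟩
  b2n (letter w n) + P w (n ∸ 1) ∸ P w (n ∸ 1)  ≡⟨ cong (_∸ P w (n ∸ 1)) (P-letter w n 1≤n n≤) ⟩
  P w n ∸ P w (n ∸ 1)                           ≡⟨ cong₂ _∸_ P-n P-n-1 ⟩
  c ∸ c'                                        ∎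
  where
  open ≡-Reasoning
  w : List Bool
  w = u m
  prefix : UpperMechanicalPrefix α w
  prefix = lazyIterates-upperMechanical α u u₀ step m
  P-n : P w n ≡ c
  P-n = IsCeil-unique α {n} (prefix n n≤) ceil-n
  P-n-1 : P w (n ∸ 1) ≡ c'
  P-n-1 = IsCeil-unique α {n ∸ 1} (prefix (n ∸ 1) (≤-trans (m∸n≤m n 1) n≤)) ceil-n-1
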